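{- Let $U$ be a subset of $\mathcal{S}$, $a$ an ASHE and $v$ its direction vector. If $a$ is unidimensional (i.e. $\{i : v_i\neq 0\}$ is a singleton), and if for every component $i$ the projection $U_i=\{x_i : x\in U\}$ is an interval, then the smallest interval containing $U\cdot a$ equals $[\inf U,\sup U]\boxdot a$.
   Context: $\mathcal{S}=[0,C]\subset\mathbb{Z}^d$ with the componentwise order. $a$ is an almost space homogeneous event (ASHE) with direction vector $v$ and blocking relation $\mathcal{R}$: with $CR(x)=\{i: x_i+v_i\notin[0,C_i]\}$ and $B(x)=\{i:\exists j\in CR(x),(j,i)\in\mathcal{R}\}$, $(x\cdot a)_i=x_i$ if $i\in B(x)$ and $(x\cdot a)_i=\max(0,\min(C_i,x_i+v_i))$ otherwise. For an interval $[m,M]$, $[m,M]\boxdot a=[\inf_{m\le x\le M} x\cdot a,\ \sup_{m\le x\le M} x\cdot a]$, the smallest interval containing $[m,M]\cdot a$. The smallest interval containing a set $W$ is $[\inf W,\sup W]$. -}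

module Defs where

open import Level using (0ℓ)
open import Data.Nat using (ℕ)
open import Data.Integer using (ℤ; +_; _+_; _≤_; _≤?_)
open import Data.Integer.Base using (_⊔_; _⊓_)
open import Data.Fin using (Fin)
open import Data.Fin.Properties using (any?)
open import Data.Product using (Σ; _×_; _,_; ∃)
open import Relation.Binary using (Rel; Decidable)
open import Relation.Nullary using (¬_; Dec; yes; no)
open import Relation.Nullary.Decidable using (_×-dec_; ¬?)
open import Relation.Binary.PropositionalEquality using (_≡_)

Pt : ℕ → Set
Pt d = Fin d → ℤ

Pred : ℕ → Set₁
Pred d = Pt d → Set

_≼_ : ∀ {d} → Pt d → Pt d → Set
x ≼ y = ∀ i → x i ≤ y i

InS : ∀ {d} → (C : Fin d → ℕ) → Pt d → Set
InS C x = ∀ i → (+ 0 ≤ x i) × (x i ≤ + C i)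

-- An almost space homogeneous event: direction vector and (decidable) blocking relation.
record ASHE (d : ℕ) : Set₁ where
  field
    v   : Fin d → ℤ
    R   : Rel (Fin d) 0ℓ
    R?  : Decidable R

module _ {d : ℕ} (C : Fin d → ℕ) (a : ASHE d) where
  open ASHE a

  CR : Pt d → Fin d → Set
  CR x i = ¬ ((+ 0 ≤ x i + v i) × (x i + v i ≤ + C i))

  CR? : (x : Pt d) → (i : Fin d) → Dec (CR x i)
  CR? x i = ¬? ((+ 0 ≤? x i + v i) ×-dec (x i + v i ≤? + C i))

  B : Pt d → Fin d → Set
  B x i = ∃ λ j → CR x j × R j i

  B? : (x : Pt d) → (i : Fin d) → Dec (B x i)
  B? x i = any? (λ j → CR? x j ×-dec R? j i)

  act : Pt d → Pt d
  act x i with B? x i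
  ... | yes _ = x i
  ... | no  _ = + 0 ⊔ (+ C i ⊓ (x i + v i))

Unidimensional : ∀ {d} → ASHE d → Set
Unidimensional {d} a = Σ (Fin d) λ k → ¬ (ASHE.v a k ≡ + 0) × (∀ i → ¬ (i ≡ k) → ASHE.v a i ≡ + 0)

ProjectionsIntervals : ∀ {d} → Pred d → Set
ProjectionsIntervals {d} U =
  ∀ (i : Fin d) (x y : Pt d) (t : ℤ) → U x → U y → x i ≤ t → t ≤ y i →
    Σ (Pt d) λ z → U z × (z i ≡ t)

IsInf : ∀ {d} → (Fin d → ℕ) → Pred d → Pt d → Set
IsInf {d} C W m = InS C m × (∀ w → W w → m ≼ w)
  × (∀ m' → InS C m' → (∀ w → W w → m' ≼ w) → m' ≼ m)

IsSup : ∀ {d} → (Fin d → ℕ) → Pred d → Pt d → Set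
IsSup {d} C W M = InS C M × (∀ w → W w → w ≼ M)
  × (∀ M' → InS C M' → (∀ w → W w → w ≼ M') → M ≼ M')

Image : ∀ {d} → (C : Fin d → ℕ) → ASHE d → Pred d → Pred d
Image {d} C a W y = Σ (Pt d) λ x → W x × (act C a x ≡ y)

Interval : ∀ {d} → Pt d → Pt d → Pred d
Interval m M x = m ≼ x × x ≼ M

-- Write [m,M] for the smallest interval of S = [0,C] containing U, [l,L] for the
-- one containing U·a and [l',L'] for the one containing [m,M]·a.  Since U ⊆ [m,M],
-- monotonicity of inf/sup gives l' ≼ l and L ≼ L'.  For the converse it suffices
-- that every x·a with x ∈ [m,M] lies in [l,L].  Let k be the unique moving
-- direction of a.
--   * For i ≠ k, (x·a)_i = x_i ∈ [m_i,M_i], and m_i ≥ l_i, M_i ≤ L_i because a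
--     does not move coordinate i of points of U.
--   * For i = k, no coordinate other than k can be critical, so (x·a)_k depends
--     only on x_k.  As U_k is an interval with inf m_k and sup M_k, some z ∈ U has
--     z_k = x_k (classically; the goal l_k ≤ (x·a)_k is decidable, so this is
--     enough), whence (x·a)_k = (z·a)_k ∈ [l_k,L_k].  If U is empty then
--     C ≼ m ≼ x ≼ M ≼ 0, so S is a single point and there is nothing to prove.
module Submission where

open import Defs
open import Data.Nat using (ℕ; z≤n)
open import Data.Fin using (Fin) renaming (_≟_ to _≟ᶠ_)
open import Data.Integer using (ℤ; +_; _+_; _⊔_; _⊓_; _≤_; _≤?_; +≤+; pred) renaming (suc to sucℤ)
open import Data.Integer.Properties
open import Data.Product using (Σ; _×_; _,_; proj₁; proj₂)
open import Data.Sum using (_⊎_; inj₁; inj₂)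
open import Data.Empty using (⊥-elim)
open import Data.Vec.Functional using (updateAt)
open import Data.Vec.Functional.Properties using (updateAt-updates; updateAt-minimal)
open import Relation.Nullary using (¬_; yes; no)
open import Relation.Nullary.Decidable using (decidable-stable; ¬¬-excluded-middle)
open import Relation.Nullary.Negation using (¬¬-map)
open import Relation.Binary.PropositionalEquality using (_≡_; refl; sym; trans; cong; subst)

updateAt-pointwise : ∀ {d} (P : Fin d → ℤ → Set) (p : Pt d) (i : Fin d) (f : ℤ → ℤ) →
  (∀ j → P j (p j)) → P i (f (p i)) → ∀ j → P j (updateAt p i f j)
updateAt-pointwise P p i f all new j with j ≟ᶠ i
... | yes refl = subst (P j) (sym (updateAt-updates j p)) new
... | no j≢i   = subst (P j) (sym (updateAt-minimal j i p j≢i)) (all j)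

module _ {d : ℕ} (C : Fin d → ℕ) where

  inf-coordinate : ∀ {W m} → IsInf C W m → ∀ i t → + 0 ≤ t → t ≤ + C i →
    (∀ w → W w → t ≤ w i) → t ≤ m i
  inf-coordinate {W} {m} (mS , m-lower , m-greatest) i t 0≤t t≤C t-lower =
    ≤-trans (i≤j⊔i (m i) t) (subst (_≤ m i) (updateAt-updates i m) (m-greatest m' m'S m'-lower i))
    where
    m' : Pt d
    m' = updateAt m i (_⊔ t)
    m'S : InS C m'
    m'S = updateAt-pointwise (λ j z → (+ 0 ≤ z) × (z ≤ + C j)) m i (_⊔ t) mS
      (≤-trans 0≤t (i≤j⊔i (m i) t) , ⊔-lub (proj₂ (mS i)) t≤C)
    m'-lower : ∀ w → W w → m' ≼ w
    m'-lower w w∈W = updateAt-pointwise (λ j z → z ≤ w j) m i (_⊔ t) (m-lower w w∈W)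
      (⊔-lub (m-lower w w∈W i) (t-lower w w∈W))

  sup-coordinate : ∀ {W M} → IsSup C W M → ∀ i t → + 0 ≤ t → t ≤ + C i →
    (∀ w → W w → w i ≤ t) → M i ≤ t
  sup-coordinate {W} {M} (MS , M-upper , M-least) i t 0≤t t≤C t-upper =
    ≤-trans (subst (M i ≤_) (updateAt-updates i M) (M-least M' M'S M'-upper i)) (i⊓j≤j (M i) t)
    where
    M' : Pt d
    M' = updateAt M i (_⊓ t)
    M'S : InS C M'
    M'S = updateAt-pointwise (λ j z → (+ 0 ≤ z) × (z ≤ + C j)) M i (_⊓ t) MS
      (⊓-glb (proj₁ (MS i)) 0≤t , ≤-trans (i⊓j≤i (M i) t) (proj₂ (MS i)))
    M'-upper : ∀ w → W w → w ≼ M'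
    M'-upper w w∈W = updateAt-pointwise (λ j z → w j ≤ z) M i (_⊓ t) (M-upper w w∈W)
      (⊓-glb (M-upper w w∈W i) (t-upper w w∈W))

  inf-antitone : ∀ {W W' m m'} → (∀ x → W x → W' x) → IsInf C W m → IsInf C W' m' → m' ≼ m
  inf-antitone W⊆W' (_ , _ , m-greatest) (m'S , m'-lower , _) =
    m-greatest _ m'S (λ w w∈W → m'-lower w (W⊆W' w w∈W))

  sup-monotone : ∀ {W W' M M'} → (∀ x → W x → W' x) → IsSup C W M → IsSup C W' M' → M ≼ M'
  sup-monotone W⊆W' (_ , _ , M-least) (M'S , M'-upper , _) =
    M-least _ M'S (λ w w∈W → M'-upper w (W⊆W' w w∈W))

  within-bounds : ∀ {W m M} → IsInf C W m → IsSup C W M → ∀ x → W x → Interval m M x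
  within-bounds (_ , m-lower , _) (_ , M-upper , _) x x∈W = m-lower x x∈W , M-upper x x∈W

  interval-in-S : ∀ {m M} → InS C m → InS C M → ∀ x → Interval m M x → InS C x
  interval-in-S mS MS x (m≼x , x≼M) j = ≤-trans (proj₁ (mS j)) (m≼x j) , ≤-trans (x≼M j) (proj₂ (MS j))

  inf-approached : ∀ {W m} → (∀ w → W w → InS C w) → Σ (Pt d) W → IsInf C W m →
    ∀ i t → m i ≤ t → ¬ ¬ Σ (Pt d) λ w → W w × (w i ≤ t)
  inf-approached {W} {m} W⊆S (u , u∈W) m-inf i t m≤t none =
    <-irrefl refl (suc[i]≤j⇒i<j (≤-trans suc-t≤m m≤t))
    where
    above : ∀ w → W w → sucℤ t ≤ w i
    above w w∈W = i<j⇒suc[i]≤j (≰⇒> (λ w≤t → none (w , w∈W , w≤t)))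
    suc-t≤m : sucℤ t ≤ m i
    suc-t≤m = inf-coordinate m-inf i (sucℤ t)
      (≤-trans (proj₁ (proj₁ m-inf i)) (≤-trans m≤t (i≤suc[i] t)))
      (≤-trans (above u u∈W) (proj₂ (W⊆S u u∈W i))) above

  sup-approached : ∀ {W M} → (∀ w → W w → InS C w) → Σ (Pt d) W → IsSup C W M →
    ∀ i t → t ≤ M i → ¬ ¬ Σ (Pt d) λ w → W w × (t ≤ w i)
  sup-approached {W} {M} W⊆S (u , u∈W) M-sup i t t≤M none =
    <-irrefl refl (i≤pred[j]⇒i<j (≤-trans t≤M M≤pred-t))
    where
    below : ∀ w → W w → w i ≤ pred t
    below w w∈W = i<j⇒i≤pred[j] (≰⇒> (λ t≤w → none (w , w∈W , t≤w)))
    M≤pred-t : M i ≤ pred t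
    M≤pred-t = sup-coordinate M-sup i (pred t)
      (≤-trans (proj₁ (W⊆S u u∈W i)) (below u u∈W))
      (≤-trans (<⇒≤ (i≤pred[j]⇒i<j ≤-refl)) (≤-trans t≤M (proj₂ (proj₁ M-sup i)))) below

  -- If W is empty then m = C and M = 0; a point of [m,M] thus forces C = 0.
  empty-interval-forces-C≡0 : ∀ {W m M} → ¬ Σ (Pt d) W → IsInf C W m → IsSup C W M →
    ∀ x → Interval m M x → ∀ i → + C i ≤ + 0
  empty-interval-forces-C≡0 {W} W-empty m-inf M-sup x (m≼x , x≼M) i =
    ≤-trans (inf-coordinate m-inf i (+ C i) (+≤+ z≤n) ≤-refl (λ w w∈W → ⊥-elim (W-empty (w , w∈W))))
      (≤-trans (m≼x i) (≤-trans (x≼M i)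
        (sup-coordinate M-sup i (+ 0) ≤-refl (+≤+ z≤n) (λ w w∈W → ⊥-elim (W-empty (w , w∈W))))))

  trivial-S : (∀ i → + C i ≤ + 0) → ∀ {p q} → InS C p → InS C q → p ≼ q
  trivial-S C≤0 pS qS i = ≤-trans (proj₂ (pS i)) (≤-trans (C≤0 i) (proj₁ (qS i)))

  projection-hits : ∀ {U m M} → (∀ x → U x → InS C x) → ProjectionsIntervals U →
    IsInf C U m → IsSup C U M → Σ (Pt d) U →
    ∀ i t → m i ≤ t → t ≤ M i → ¬ ¬ Σ (Pt d) λ z → U z × (z i ≡ t)
  projection-hits U⊆S intervals m-inf M-sup nonempty i t m≤t t≤M no-hit =
    inf-approached U⊆S nonempty m-inf i t m≤t λ { (x , x∈U , x≤t) →
      sup-approached U⊆S nonempty M-sup i t t≤M λ { (y , y∈U , t≤y) →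
        no-hit (intervals i x y t x∈U y∈U x≤t t≤y) } }

module _ {d : ℕ} (C : Fin d → ℕ) (a : ASHE d) where
  open ASHE a

  act-cases : ∀ x i → (B C a x i × act C a x i ≡ x i)
                    ⊎ (¬ B C a x i × act C a x i ≡ + 0 ⊔ (+ C i ⊓ (x i + v i)))
  act-cases x i with B? C a x i
  ... | yes b = inj₁ (b , refl)
  ... | no ¬b = inj₂ (¬b , refl)

  act-in-S : ∀ x → InS C x → InS C (act C a x)
  act-in-S x xS i with act-cases x i
  ... | inj₁ (_ , e) rewrite e = xS i
  ... | inj₂ (_ , e) rewrite e = i≤i⊔j _ _ , ⊔-lub (+≤+ z≤n) (i⊓j≤i _ _)

  act-fixes : ∀ x → InS C x → ∀ i → v i ≡ + 0 → act C a x i ≡ x i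
  act-fixes x xS i vᵢ≡0 with act-cases x i
  ... | inj₁ (_ , e) = e
  ... | inj₂ (_ , e) rewrite e | vᵢ≡0 | +-identityʳ (x i) =
    trans (cong (+ 0 ⊔_) (i≥j⇒i⊓j≡j (proj₂ (xS i)))) (i≤j⇒i⊔j≡j (proj₁ (xS i)))

  not-critical : ∀ x → InS C x → ∀ j → v j ≡ + 0 → ¬ CR C a x j
  not-critical x xS j vⱼ≡0 critical rewrite vⱼ≡0 | +-identityʳ (x j) = critical (xS j)

  -- In a coordinate i that a does not move, the image W·a has the same i-th
  -- coordinates as W, so its bounds l, L satisfy l_i ≤ m_i and M_i ≤ L_i.
  image-inf-coordinate : ∀ {W m l} → (∀ w → W w → InS C w) → IsInf C W m →
    IsInf C (Image C a W) l → ∀ i → v i ≡ + 0 → l i ≤ m i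
  image-inf-coordinate W⊆S m-inf (lS , l-lower , _) i vᵢ≡0 =
    inf-coordinate C m-inf i _ (proj₁ (lS i)) (proj₂ (lS i)) λ w w∈W →
      subst (_ ≤_) (act-fixes w (W⊆S w w∈W) i vᵢ≡0) (l-lower (act C a w) (w , w∈W , refl) i)

  image-sup-coordinate : ∀ {W M L} → (∀ w → W w → InS C w) → IsSup C W M →
    IsSup C (Image C a W) L → ∀ i → v i ≡ + 0 → M i ≤ L i
  image-sup-coordinate W⊆S M-sup (LS , L-upper , _) i vᵢ≡0 =
    sup-coordinate C M-sup i _ (proj₁ (LS i)) (proj₂ (LS i)) λ w w∈W →
      subst (_≤ _) (act-fixes w (W⊆S w w∈W) i vᵢ≡0) (L-upper (act C a w) (w , w∈W , refl) i)

  -- If k is the only moving direction, (x·a)_k on S depends on x_k alone: only k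
  -- can be critical, and whether it is only depends on x_k.
  module _ (k : Fin d) (others-fixed : ∀ i → ¬ (i ≡ k) → v i ≡ + 0) where

    blocked-transfer : ∀ x y → InS C x → x k ≡ y k → B C a x k → B C a y k
    blocked-transfer x y xS xₖ≡yₖ (j , critical , jRk) with j ≟ᶠ k
    ... | yes refl = j , subst (λ z → ¬ ((+ 0 ≤ z + v k) × (z + v k ≤ + C k))) xₖ≡yₖ critical , jRk
    ... | no j≢k   = ⊥-elim (not-critical x xS j (others-fixed j j≢k) critical)

    act-local : ∀ x y → InS C x → InS C y → x k ≡ y k → act C a x k ≡ act C a y k
    act-local x y xS yS xₖ≡yₖ with act-cases x k | act-cases y k
    ... | inj₁ (_ , ex) | inj₁ (_ , ey) = trans ex (trans xₖ≡yₖ (sym ey))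
    ... | inj₂ (_ , ex) | inj₂ (_ , ey) =
      trans ex (trans (cong (λ z → + 0 ⊔ (+ C k ⊓ (z + v k))) xₖ≡yₖ) (sym ey))
    ... | inj₁ (b , _)  | inj₂ (¬b , _) = ⊥-elim (¬b (blocked-transfer x y xS xₖ≡yₖ b))
    ... | inj₂ (¬b , _) | inj₁ (b , _)  = ⊥-elim (¬b (blocked-transfer y x yS (sym xₖ≡yₖ) b))

module ImageOfSpan {d : ℕ} (C : Fin d → ℕ) (a : ASHE d) (U : Pred d)
  (U⊆S : ∀ x → U x → InS C x) (unidim : Unidimensional a) (intervals : ProjectionsIntervals U)
  {m M l L : Pt d} (m-inf : IsInf C U m) (M-sup : IsSup C U M)
  (l-inf : IsInf C (Image C a U) l) (L-sup : IsSup C (Image C a U) L) where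

  k : Fin d
  k = proj₁ unidim

  others-fixed : ∀ i → ¬ (i ≡ k) → ASHE.v a i ≡ + 0
  others-fixed = proj₂ (proj₂ unidim)

  span-in-S : ∀ x → Interval m M x → InS C x
  span-in-S = interval-in-S C (proj₁ m-inf) (proj₁ M-sup)

  moving-coordinate-witness : ∀ x → Interval m M x →
    ¬ ¬ (¬ Σ (Pt d) U ⊎ Σ (Pt d) λ z → U z × (act C a z k ≡ act C a x k))
  moving-coordinate-witness x (m≼x , x≼M) no-witness = ¬¬-excluded-middle λ where
    (no empty)    → no-witness (inj₁ empty)
    (yes nonempty) → projection-hits C U⊆S intervals m-inf M-sup nonempty k (x k) (m≼x k) (x≼M k)
      λ { (z , z∈U , zₖ≡xₖ) → no-witness (inj₂ (z , z∈U ,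
        act-local C a k others-fixed z x (U⊆S z z∈U) (span-in-S x (m≼x , x≼M)) zₖ≡xₖ)) }

  span-image-above : ∀ x → Interval m M x → l ≼ act C a x
  span-image-above x x∈span i with i ≟ᶠ k
  ... | no i≢k rewrite act-fixes C a x (span-in-S x x∈span) i (others-fixed i i≢k) =
    ≤-trans (image-inf-coordinate C a U⊆S m-inf l-inf i (others-fixed i i≢k)) (proj₁ x∈span i)
  ... | yes refl = decidable-stable (l k ≤? act C a x k)
    (¬¬-map bound (moving-coordinate-witness x x∈span))
    where
    bound : ¬ Σ (Pt d) U ⊎ Σ (Pt d) (λ z → U z × (act C a z k ≡ act C a x k)) → l k ≤ act C a x k
    bound (inj₁ empty) = trivial-S C (empty-interval-forces-C≡0 C empty m-inf M-sup x x∈span)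
      (proj₁ l-inf) (act-in-S C a x (span-in-S x x∈span)) k
    bound (inj₂ (z , z∈U , same)) = subst (l k ≤_) same (proj₁ (proj₂ l-inf) _ (z , z∈U , refl) k)

  span-image-below : ∀ x → Interval m M x → act C a x ≼ L
  span-image-below x x∈span i with i ≟ᶠ k
  ... | no i≢k rewrite act-fixes C a x (span-in-S x x∈span) i (others-fixed i i≢k) =
    ≤-trans (proj₂ x∈span i) (image-sup-coordinate C a U⊆S M-sup L-sup i (others-fixed i i≢k))
  ... | yes refl = decidable-stable (act C a x k ≤? L k)
    (¬¬-map bound (moving-coordinate-witness x x∈span))
    where
    bound : ¬ Σ (Pt d) U ⊎ Σ (Pt d) (λ z → U z × (act C a z k ≡ act C a x k)) → act C a x k ≤ L k
    bound (inj₁ empty) = trivial-S C (empty-interval-forces-C≡0 C empty m-inf M-sup x x∈span)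
      (act-in-S C a x (span-in-S x x∈span)) (proj₁ L-sup) k
    bound (inj₂ (z , z∈U , same)) = subst (_≤ L k) same (proj₁ (proj₂ L-sup) _ (z , z∈U , refl) k)

image-mono : ∀ {d} (C : Fin d → ℕ) (a : ASHE d) {W W' : Pred d} →
  (∀ x → W x → W' x) → ∀ y → Image C a W y → Image C a W' y
image-mono C a W⊆W' y (x , x∈W , e) = x , W⊆W' x x∈W , e

proposition5 : (d : ℕ) (C : Fin d → ℕ) (a : ASHE d) (U : Pred d) →
    (∀ x → U x → InS C x) →
    Unidimensional a →
    ProjectionsIntervals U →
    (m M : Pt d) → IsInf C U m → IsSup C U M →
    (l L : Pt d) → IsInf C (Image C a U) l → IsSup C (Image C a U) L →
    (l' L' : Pt d) → IsInf C (Image C a (Interval m M)) l' → IsSup C (Image C a (Interval m M)) L' →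
    (∀ i → l i ≡ l' i) × (∀ i → L i ≡ L' i)
proposition5 d C a U U⊆S unidim intervals m M m-inf M-sup l L l-inf L-sup l' L' l'-inf L'-sup =
  (λ i → ≤-antisym (l≼l' i) (l'≼l i)) , (λ i → ≤-antisym (L≼L' i) (L'≼L i))
  where
  open ImageOfSpan C a U U⊆S unidim intervals m-inf M-sup l-inf L-sup
  U·a⊆span·a : ∀ y → Image C a U y → Image C a (Interval m M) y
  U·a⊆span·a = image-mono C a (within-bounds C m-inf M-sup)
  -- [l,L] contains [m,M]·a, hence [l',L'] ⊆ [l,L] ...
  l≼l' : l ≼ l'
  l≼l' = proj₂ (proj₂ l'-inf) l (proj₁ l-inf) λ { y (x , x∈span , refl) → span-image-above x x∈span }
  L'≼L : L' ≼ L
  L'≼L = proj₂ (proj₂ L'-sup) L (proj₁ L-sup) λ { y (x , x∈span , refl) → span-image-below x x∈span }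
  -- ... and U ⊆ [m,M] gives the reverse inclusion.
  l'≼l : l' ≼ l
  l'≼l = inf-antitone C U·a⊆span·a l-inf l'-inf
  L≼L' : L ≼ L'
  L≼L' = sup-monotone C U·a⊆span·a L-sup L'-sup
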